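{- Let $G$ be an irreflexive oriented graph. Then $G$ has an ios-injective homomorphism to $T_3$ if and only if no orientation of the 4-cycle is a subgraph of $G$ and none of $C_3, P_4, H_4, H_4^c, H_5, H_5^c, A_4, A_4^c, B_2, B_2^c$ is a subgraph of $G$.
   Context: An oriented graph is a directed graph in which, for any two distinct vertices, at most one of the two possible arcs between them is present. A homomorphism is ios-injective if for every vertex $x$ it is injective on the in-neighbourhood $N^-(x)$ and on the out-neighbourhood $N^+(x)$. $T_3$ has vertices $t_0,t_1,t_2$ and arcs $t_it_j$ for $i<j$. $C_3$ is the directed 3-cycle. The superscript $c$ denotes the converse (all arcs reversed). $P_4$ is the directed path $a\to b\to c\to d$. $H_4$ has arcs $h_0h_3,h_1h_3,h_2h_3$. $A_4$ has arcs $h_0h_2,h_1h_2,h_2h_3$. $H_5$ has arcs $c\to b, b\to a, c\to d, d\to e$ (two directed paths of length two sharing their initial vertex). $B_2$ is the oriented path $a\to b\leftarrow c\to d\leftarrow e$. -}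

module Defs where

open import Data.Nat using (ℕ; suc)
open import Data.Fin using (Fin; zero; suc; toℕ; _≟_)
open import Data.Fin.Patterns using (0F; 1F; 2F; 3F; 4F)
open import Data.Bool using (Bool; true; false; T; _∧_; _∨_; not)
open import Data.List using (List; []; _∷_)
open import Data.Product using (_×_; _,_; Σ; ∃)
open import Data.Sum using (_⊎_)
open import Relation.Nullary using (¬_; does)
open import Relation.Binary.PropositionalEquality using (_≡_)
import Data.Nat as ℕ

record Digraph : Set where
  constructor digraph
  field
    size : ℕ
    arc  : Fin size → Fin size → Bool

open Digraph public

Vertex : Digraph → Set
Vertex G = Fin (size G)

Arc : (G : Digraph) → Vertex G → Vertex G → Set
Arc G x y = T (arc G x y)

Irreflexive : Digraph → Set
Irreflexive G = ∀ x → ¬ Arc G x x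

Oriented : Digraph → Set
Oriented G = ∀ x y → Arc G x y → ¬ Arc G y x

IsHom : (G H : Digraph) → (Vertex G → Vertex H) → Set
IsHom G H f = ∀ x y → Arc G x y → Arc H (f x) (f y)

IosInjective : (G H : Digraph) → (Vertex G → Vertex H) → Set
IosInjective G H f =
  (∀ x y z → Arc G y x → Arc G z x → f y ≡ f z → y ≡ z) ×
  (∀ x y z → Arc G x y → Arc G x z → f y ≡ f z → y ≡ z)

HasIosHom : Digraph → Digraph → Set
HasIosHom G H = Σ (Vertex G → Vertex H) λ f → IsHom G H f × IosInjective G H f

-- H is a subgraph of G: there is an injective homomorphism H → G
-- (not necessarily induced)
SubgraphOf : Digraph → Digraph → Set
SubgraphOf H G = Σ (Vertex H → Vertex G) λ f →
  IsHom H G f × (∀ x y → f x ≡ f y → x ≡ y)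

converse : Digraph → Digraph
converse G = digraph (size G) (λ x y → arc G y x)

fromArcs : (k : ℕ) → List (Fin k × Fin k) → Digraph
fromArcs k as = digraph k (λ x y → mem x y as)
  where
  mem : Fin k → Fin k → List (Fin k × Fin k) → Bool
  mem x y [] = false
  mem x y ((a , b) ∷ rest) = (does (x ≟ a) ∧ does (y ≟ b)) ∨ mem x y rest

T3 : Digraph
T3 = digraph 3 (λ i j → toℕ i ℕ.<ᵇ toℕ j)

C3 : Digraph
C3 = fromArcs 3 ((0F , 1F) ∷ (1F , 2F) ∷ (2F , 0F) ∷ [])

P4 : Digraph
P4 = fromArcs 4 ((0F , 1F) ∷ (1F , 2F) ∷ (2F , 3F) ∷ [])

H4 : Digraph
H4 = fromArcs 4 ((0F , 3F) ∷ (1F , 3F) ∷ (2F , 3F) ∷ [])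

A4 : Digraph
A4 = fromArcs 4 ((0F , 2F) ∷ (1F , 2F) ∷ (2F , 3F) ∷ [])

H5 : Digraph
H5 = fromArcs 5 ((2F , 1F) ∷ (1F , 0F) ∷ (2F , 3F) ∷ (3F , 4F) ∷ [])

B2 : Digraph
B2 = fromArcs 5 ((0F , 1F) ∷ (2F , 1F) ∷ (2F , 3F) ∷ (4F , 3F) ∷ [])

next4 : Fin 4 → Fin 4
next4 0F = 1F
next4 1F = 2F
next4 2F = 3F
next4 3F = 0F

-- the orientation of the 4-cycle 0-1-2-3-0 determined by o:
-- edge {i, i+1} is oriented i → i+1 if o i = true, else i+1 → i.
-- Every orientation of C₄ arises this way.
C4orient : (Fin 4 → Bool) → Digraph
C4orient o = digraph 4 (λ x y →
  (does (y ≟ next4 x) ∧ o x) ∨ (does (x ≟ next4 y) ∧ not (o y)))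

-- An ios-homomorphism to T₃ is a level function into {0, 1, 2} that increases
-- along arcs and separates the predecessors, and the successors, of every
-- vertex.  Such a function forces five local constraints on a graph and on its
-- converse, and each forbidden subgraph breaks one of them.  Conversely, in an
-- irreflexive oriented graph without the forbidden subgraphs the constraints
-- hold, and then the following levels work: 1 for vertices with both
-- predecessors and successors and for isolated vertices, 0 for sources and 2
-- for sinks, except that of two sources with a common successor one is raised
-- to 1, and dually for sinks.

module Submission where

open import Defs
open import Data.Bool using (Bool; true; false; T; not; _∧_; if_then_else_)
open import Data.Bool.Properties using (T-∨)
open import Data.Empty using (⊥; ⊥-elim)
open import Data.Fin using (Fin; _<_; opposite)
open import Data.Fin.Patterns using (0F; 1F; 2F; 3F; 4F)
open import Data.Fin.Properties using (_≟_; _<?_; any?; all?; <-cmp; <-asym; <⇒≢; opposite-involutive)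
open import Data.List using (List; _∷_)
open import Data.List.Relation.Unary.All using (All; []; _∷_)
open import Data.Vec.Relation.Unary.All using ([]; _∷_)
open import Data.Product using (_×_; _,_; ∃; ∃₂)
open import Data.Sum using (_⊎_; inj₁; inj₂; [_,_]′)
open import Data.Unit using (tt)
open import Data.Vec using (Vec; []; _∷_; lookup)
open import Data.Vec.Relation.Unary.AllPairs using ([]; _∷_)
open import Data.Vec.Relation.Unary.Unique.Propositional using (Unique)
open import Data.Vec.Relation.Unary.Unique.Propositional.Properties using (lookup-injective)
open import Function using (_∘_)
open import Function.Bundles using (_⇔_; mk⇔; Equivalence)
open import Relation.Binary.Definitions using (tri<; tri≈; tri>)
open import Relation.Binary.PropositionalEquality using (_≡_; _≢_; refl; sym; trans; cong; ≢-sym)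
open import Relation.Nullary using (¬_; Dec; yes; no; does)
open import Relation.Nullary.Decidable using (T?; ¬?; _×-dec_; _⊎-dec_; _→-dec_; decidable-stable)

T3-middle : ∀ {i j k} → Arc T3 i j → Arc T3 j k → j ≡ 1F
T3-middle {0F} {1F} {2F} _ _ = refl

T3-path3 : ∀ {i j k l} → Arc T3 i j → Arc T3 j k → Arc T3 k l → ⊥
T3-path3 {0F} {1F} {2F} {0F} _ _ ()
T3-path3 {0F} {1F} {2F} {1F} _ _ ()
T3-path3 {0F} {1F} {2F} {2F} _ _ ()

T3-join : ∀ {i j k} → Arc T3 i k → Arc T3 j k → i ≢ j → k ≡ 2F
T3-join {k = 2F} _ _ _ = refl
T3-join {0F} {0F} {1F} _ _ i≢j = ⊥-elim (i≢j refl)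

T3-three-preds : ∀ {i j k l} → Arc T3 i l → Arc T3 j l → Arc T3 k l →
                 i ≢ j → i ≢ k → j ≢ k → ⊥
T3-three-preds {0F} {0F} _ _ _ i≢j _ _ = i≢j refl
T3-three-preds {1F} {1F} _ _ _ i≢j _ _ = i≢j refl
T3-three-preds {0F} {1F} {0F} {2F} _ _ _ _ i≢k _ = i≢k refl
T3-three-preds {0F} {1F} {1F} {2F} _ _ _ _ _ j≢k = j≢k refl
T3-three-preds {1F} {0F} {0F} {2F} _ _ _ _ _ j≢k = j≢k refl
T3-three-preds {1F} {0F} {1F} {2F} _ _ _ _ i≢k _ = i≢k refl
T3-three-preds {2F} {l = 2F} () _ _ _ _ _
T3-three-preds {j = 2F} {l = 2F} _ () _ _ _ _

T3-opposite : ∀ {i j} → Arc T3 i j → Arc T3 (opposite j) (opposite i)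
T3-opposite {0F} {1F} _ = tt
T3-opposite {0F} {2F} _ = tt
T3-opposite {1F} {2F} _ = tt

ios-restrict : ∀ {H G K} → SubgraphOf H G → HasIosHom G K → HasIosHom H K
ios-restrict (g , g-hom , g-inj) (f , f-hom , in-inj , out-inj) =
  f ∘ g ,
  (λ x y x→y → f-hom (g x) (g y) (g-hom x y x→y)) ,
  (λ x y z y→x z→x e → g-inj y z (in-inj (g x) (g y) (g z) (g-hom y x y→x) (g-hom z x z→x) e)) ,
  (λ x y z x→y x→z e → g-inj y z (out-inj (g x) (g y) (g z) (g-hom x y x→y) (g-hom x z x→z) e))

opposite-injective : ∀ {n} {i j : Fin n} → opposite i ≡ opposite j → i ≡ j
opposite-injective {i = i} {j} e =
  trans (sym (opposite-involutive i)) (trans (cong opposite e) (opposite-involutive j))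

ios-converse : ∀ {G} → HasIosHom G T3 → HasIosHom (converse G) T3
ios-converse (f , hom , in-inj , out-inj) =
  opposite ∘ f ,
  (λ x y y→x → T3-opposite {f y} {f x} (hom y x y→x)) ,
  (λ x y z x→y x→z e → out-inj x y z x→y x→z (opposite-injective e)) ,
  (λ x y z y→x z→x e → in-inj x y z y→x z→x (opposite-injective e))

NoWalk3 : Digraph → Set
NoWalk3 G = ∀ {w x y z} → Arc G w x → Arc G x y → Arc G y z → ⊥

-- Each field forbids one of the subgraphs but assumes only the distinctness that
-- a level function needs to rule it out; when further vertices coincide, another
-- forbidden configuration appears.
record T3Local (G : Digraph) : Set where
  field
    noWalk3 : NoWalk3 G
    noA4    : ∀ {u v x y} → Arc G u x → Arc G v x → Arc G x y → u ≢ v → ⊥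
    noH4    : ∀ {a b c x} → Arc G a x → Arc G b x → Arc G c x →
              a ≢ b → a ≢ c → b ≢ c → ⊥
    noH5    : ∀ {x y y′ z z′} → Arc G x y → Arc G y y′ → Arc G x z → Arc G z z′ →
              y ≢ z → ⊥
    noB2    : ∀ {a b c d e} → Arc G a b → Arc G c b → Arc G c d → Arc G e d →
              a ≢ c → c ≢ e → b ≢ d → ⊥

open T3Local

ios⇒local : ∀ {G} → HasIosHom G T3 → T3Local G
ios⇒local {G} (f , hom , in-inj , out-inj) = record
  { noWalk3 = λ {w} {x} {y} {z} w→x x→y y→z →
      T3-path3 {f w} {f x} {f y} {f z} (hom w x w→x) (hom x y x→y) (hom y z y→z)
  ; noA4    = λ u→x v→x x→y u≢v →
      1F≢2F (trans (sym (middle-level u→x x→y)) (join-level u→x v→x u≢v))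
  ; noH4    = λ {a} {b} {c} {x} a→x b→x c→x a≢b a≢c b≢c →
      T3-three-preds {f a} {f b} {f c} {f x} (hom a x a→x) (hom b x b→x) (hom c x c→x)
        (pred-levels a→x b→x a≢b) (pred-levels a→x c→x a≢c) (pred-levels b→x c→x b≢c)
  ; noH5    = λ x→y y→y′ x→z z→z′ y≢z →
      succ-levels x→y x→z y≢z (trans (middle-level x→y y→y′) (sym (middle-level x→z z→z′)))
  ; noB2    = λ a→b c→b c→d e→d a≢c c≢e b≢d →
      succ-levels c→b c→d b≢d (trans (join-level a→b c→b a≢c) (sym (join-level c→d e→d c≢e)))
  }
  where
  1F≢2F : 1F ≢ 2F
  1F≢2F ()
  pred-levels : ∀ {x y z} → Arc G y x → Arc G z x → y ≢ z → f y ≢ f z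
  pred-levels y→x z→x y≢z = y≢z ∘ in-inj _ _ _ y→x z→x
  succ-levels : ∀ {x y z} → Arc G x y → Arc G x z → y ≢ z → f y ≢ f z
  succ-levels x→y x→z y≢z = y≢z ∘ out-inj _ _ _ x→y x→z
  middle-level : ∀ {x y z} → Arc G x y → Arc G y z → f y ≡ 1F
  middle-level {x} {y} {z} x→y y→z = T3-middle {f x} {f y} {f z} (hom x y x→y) (hom y z y→z)
  join-level : ∀ {x y z} → Arc G y x → Arc G z x → y ≢ z → f x ≡ 2F
  join-level {x} {y} {z} y→x z→x y≢z =
    T3-join {f y} {f z} {f x} (hom y x y→x) (hom z x z→x) (pred-levels y→x z→x y≢z)

C3-nonlocal : ¬ T3Local C3
C3-nonlocal L = noWalk3 L {0F} {1F} {2F} {0F} tt tt tt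

P4-nonlocal : ¬ T3Local P4
P4-nonlocal L = noWalk3 L {0F} {1F} {2F} {3F} tt tt tt

H4-nonlocal : ¬ T3Local H4
H4-nonlocal L = noH4 L {0F} {1F} {2F} {3F} tt tt tt (λ ()) (λ ()) (λ ())

A4-nonlocal : ¬ T3Local A4
A4-nonlocal L = noA4 L {0F} {1F} {2F} {3F} tt tt tt (λ ())

H5-nonlocal : ¬ T3Local H5
H5-nonlocal L = noH5 L {2F} {1F} {0F} {3F} {4F} tt tt tt tt (λ ())

B2-nonlocal : ¬ T3Local B2
B2-nonlocal L = noB2 L {0F} {1F} {2F} {3F} {4F} tt tt tt tt (λ ()) (λ ()) (λ ())

module _ (o : Fin 4 → Bool) where

  fwd-arc : ∀ i → o i ≡ true → Arc (C4orient o) i (next4 i)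
  fwd-arc 0F e rewrite e = tt
  fwd-arc 1F e rewrite e = tt
  fwd-arc 2F e rewrite e = tt
  fwd-arc 3F e rewrite e = tt

  bwd-arc : ∀ i → o i ≡ false → Arc (C4orient o) (next4 i) i
  bwd-arc 0F e rewrite e = tt
  bwd-arc 1F e rewrite e = tt
  bwd-arc 2F e rewrite e = tt
  bwd-arc 3F e rewrite e = tt

  -- Depending on the orientation the 4-cycle contains a directed path of length
  -- three, is the union of two directed paths of length two from a source to a
  -- sink (an H₅ with y′ = z′), or alternates (a B₂ with a = e).
  C4-nonlocal : ¬ T3Local (C4orient o)
  C4-nonlocal L with o 0F in e₀ | o 1F in e₁ | o 2F in e₂ | o 3F in e₃
  ... | true  | true  | true  | true =
    noWalk3 L {0F} {1F} {2F} {3F} (fwd-arc 0F e₀) (fwd-arc 1F e₁) (fwd-arc 2F e₂)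
  ... | true  | true  | true  | false =
    noWalk3 L {0F} {1F} {2F} {3F} (fwd-arc 0F e₀) (fwd-arc 1F e₁) (fwd-arc 2F e₂)
  ... | true  | true  | false | true =
    noWalk3 L {3F} {0F} {1F} {2F} (fwd-arc 3F e₃) (fwd-arc 0F e₀) (fwd-arc 1F e₁)
  ... | true  | false | true  | true =
    noWalk3 L {2F} {3F} {0F} {1F} (fwd-arc 2F e₂) (fwd-arc 3F e₃) (fwd-arc 0F e₀)
  ... | false | true  | true  | true =
    noWalk3 L {1F} {2F} {3F} {0F} (fwd-arc 1F e₁) (fwd-arc 2F e₂) (fwd-arc 3F e₃)
  ... | false | false | false | false =
    noWalk3 L {3F} {2F} {1F} {0F} (bwd-arc 2F e₂) (bwd-arc 1F e₁) (bwd-arc 0F e₀)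
  ... | false | false | false | true =
    noWalk3 L {3F} {2F} {1F} {0F} (bwd-arc 2F e₂) (bwd-arc 1F e₁) (bwd-arc 0F e₀)
  ... | false | false | true  | false =
    noWalk3 L {2F} {1F} {0F} {3F} (bwd-arc 1F e₁) (bwd-arc 0F e₀) (bwd-arc 3F e₃)
  ... | false | true  | false | false =
    noWalk3 L {1F} {0F} {3F} {2F} (bwd-arc 0F e₀) (bwd-arc 3F e₃) (bwd-arc 2F e₂)
  ... | true  | false | false | false =
    noWalk3 L {0F} {3F} {2F} {1F} (bwd-arc 3F e₃) (bwd-arc 2F e₂) (bwd-arc 1F e₁)
  ... | true  | true  | false | false =
    noH5 L {0F} {1F} {2F} {3F} {2F} (fwd-arc 0F e₀) (fwd-arc 1F e₁) (bwd-arc 3F e₃) (bwd-arc 2F e₂) (λ ())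
  ... | false | true  | true  | false =
    noH5 L {1F} {2F} {3F} {0F} {3F} (fwd-arc 1F e₁) (fwd-arc 2F e₂) (bwd-arc 0F e₀) (bwd-arc 3F e₃) (λ ())
  ... | false | false | true  | true =
    noH5 L {2F} {3F} {0F} {1F} {0F} (fwd-arc 2F e₂) (fwd-arc 3F e₃) (bwd-arc 1F e₁) (bwd-arc 0F e₀) (λ ())
  ... | true  | false | false | true =
    noH5 L {3F} {0F} {1F} {2F} {1F} (fwd-arc 3F e₃) (fwd-arc 0F e₀) (bwd-arc 2F e₂) (bwd-arc 1F e₁) (λ ())
  ... | true  | false | true  | false =
    noB2 L {0F} {1F} {2F} {3F} {0F} (fwd-arc 0F e₀) (bwd-arc 1F e₁) (fwd-arc 2F e₂) (bwd-arc 3F e₃) (λ ()) (λ ()) (λ ())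
  ... | false | true  | false | true =
    noB2 L {1F} {2F} {3F} {0F} {1F} (fwd-arc 1F e₁) (bwd-arc 2F e₂) (fwd-arc 3F e₃) (bwd-arc 0F e₀) (λ ()) (λ ()) (λ ())

subgraph-converse : ∀ {H G} → SubgraphOf H (converse G) → SubgraphOf (converse H) G
subgraph-converse (f , hom , inj) = f , (λ x y y→x → hom y x y→x) , inj

module Embedding (G : Digraph) where

  embedding : ∀ {H} (vs : Vec (Vertex G) (size H)) → Unique vs → IsHom H G (lookup vs) →
              SubgraphOf H G
  embedding vs distinct hom = lookup vs , hom , lookup-injective distinct

  fromArcs-hom : ∀ {k} (as : List (Fin k × Fin k)) (f : Fin k → Vertex G) →
                 All (λ (a , b) → Arc G (f a) (f b)) as → IsHom (fromArcs k as) G f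
  fromArcs-hom ((a , b) ∷ as) f (a→b ∷ arcs) x y x→y with x ≟ a | y ≟ b
  ... | yes refl | yes refl = a→b
  ... | yes refl | no _     = fromArcs-hom as f arcs x y x→y
  ... | no _     | _        = fromArcs-hom as f arcs x y x→y

  module _ (o : Fin 4 → Bool) (f : Fin 4 → Vertex G)
           (edge : ∀ i → if o i then Arc G (f i) (f (next4 i)) else Arc G (f (next4 i)) (f i))
           where

    forward-edge : ∀ x y → T (does (y ≟ next4 x) ∧ o x) → Arc G (f x) (f y)
    forward-edge x y p with y ≟ next4 x | o x | edge x
    ... | yes refl | true  | x→y = x→y
    ... | yes refl | false | _   = ⊥-elim p
    ... | no _     | _     | _   = ⊥-elim p

    backward-edge : ∀ x y → T (does (x ≟ next4 y) ∧ not (o y)) → Arc G (f x) (f y)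
    backward-edge x y p with x ≟ next4 y | o y | edge y
    ... | yes refl | false | x→y = x→y
    ... | yes refl | true  | _   = ⊥-elim p
    ... | no _     | _     | _   = ⊥-elim p

    C4orient-hom : IsHom (C4orient o) G f
    C4orient-hom x y x→y =
      [ forward-edge x y , backward-edge x y ]′
        (Equivalence.to (T-∨ {does (y ≟ next4 x) ∧ o x}) x→y)

NoDiamond : Digraph → Set
NoDiamond G = ∀ {x y z t} → Arc G x y → Arc G y t → Arc G x z → Arc G z t → y ≢ z → ⊥

NoAltSquare : Digraph → Set
NoAltSquare G = ∀ {w x y z} → Arc G w y → Arc G x y → Arc G x z → Arc G w z →
                w ≢ x → y ≢ z → ⊥

oriented-converse : ∀ {G} → Oriented G → Oriented (converse G)
oriented-converse ori x y y→x x→y = ori y x y→x x→y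

noWalk3-converse : ∀ {G} → NoWalk3 G → NoWalk3 (converse G)
noWalk3-converse noWalk3 x→w y→x z→y = noWalk3 z→y y→x x→w

noDiamond-converse : ∀ {G} → NoDiamond G → NoDiamond (converse G)
noDiamond-converse noDiamond y→x t→y z→x t→z = noDiamond t→y y→x t→z z→x

noAltSquare-converse : ∀ {G} → NoAltSquare G → NoAltSquare (converse G)
noAltSquare-converse noAltSquare y→w y→x z→x z→w w≢x y≢z =
  noAltSquare y→w z→w z→x y→x y≢z w≢x

diamond : Fin 4 → Bool
diamond = lookup (true ∷ true ∷ false ∷ false ∷ [])

alternating : Fin 4 → Bool
alternating = lookup (true ∷ false ∷ true ∷ false ∷ [])

module FromSubgraphs {G : Digraph} (irr : Irreflexive G) (ori : Oriented G) where

  open Embedding G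

  arc⇒≢ : ∀ {x y} → Arc G x y → x ≢ y
  arc⇒≢ x→y refl = irr _ x→y

  path2⇒≢ : ∀ {x y z} → Arc G x y → Arc G y z → x ≢ z
  path2⇒≢ x→y y→z refl = ori _ _ x→y y→z

  noWalk3-from : ¬ SubgraphOf C3 G → ¬ SubgraphOf P4 G → NoWalk3 G
  noWalk3-from ¬C3 ¬P4 {w} {x} {y} {z} w→x x→y y→z with w ≟ z
  ... | yes refl = ¬C3 (embedding (w ∷ x ∷ y ∷ [])
        ((arc⇒≢ w→x ∷ path2⇒≢ w→x x→y ∷ []) ∷ (arc⇒≢ x→y ∷ []) ∷ [] ∷ [])
        (fromArcs-hom _ _ (w→x ∷ x→y ∷ y→z ∷ [])))
  ... | no w≢z = ¬P4 (embedding (w ∷ x ∷ y ∷ z ∷ [])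
        ((arc⇒≢ w→x ∷ path2⇒≢ w→x x→y ∷ w≢z ∷ []) ∷ (arc⇒≢ x→y ∷ path2⇒≢ x→y y→z ∷ []) ∷
         (arc⇒≢ y→z ∷ []) ∷ [] ∷ [])
        (fromArcs-hom _ _ (w→x ∷ x→y ∷ y→z ∷ [])))

  noDiamond-from : ¬ SubgraphOf (C4orient diamond) G → NoDiamond G
  noDiamond-from ¬D {x} {y} {z} {t} x→y y→t x→z z→t y≢z =
    ¬D (embedding (x ∷ y ∷ t ∷ z ∷ [])
    ((arc⇒≢ x→y ∷ path2⇒≢ x→y y→t ∷ arc⇒≢ x→z ∷ []) ∷ (arc⇒≢ y→t ∷ y≢z ∷ []) ∷
     (≢-sym (arc⇒≢ z→t) ∷ []) ∷ [] ∷ [])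
    (C4orient-hom diamond _ λ { 0F → x→y ; 1F → y→t ; 2F → z→t ; 3F → x→z }))

  noAltSquare-from : ¬ SubgraphOf (C4orient alternating) G → NoAltSquare G
  noAltSquare-from ¬S {w} {x} {y} {z} w→y x→y x→z w→z w≢x y≢z =
    ¬S (embedding (w ∷ y ∷ x ∷ z ∷ [])
    ((arc⇒≢ w→y ∷ w≢x ∷ arc⇒≢ w→z ∷ []) ∷ (≢-sym (arc⇒≢ x→y) ∷ y≢z ∷ []) ∷
     (arc⇒≢ x→z ∷ []) ∷ [] ∷ [])
    (C4orient-hom alternating _ λ { 0F → w→y ; 1F → x→y ; 2F → x→z ; 3F → w→z }))

  noH4-from : ¬ SubgraphOf H4 G → ∀ {a b c x} → Arc G a x → Arc G b x → Arc G c x →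
              a ≢ b → a ≢ c → b ≢ c → ⊥
  noH4-from ¬H4 {a} {b} {c} {x} a→x b→x c→x a≢b a≢c b≢c =
    ¬H4 (embedding (a ∷ b ∷ c ∷ x ∷ [])
    ((a≢b ∷ a≢c ∷ arc⇒≢ a→x ∷ []) ∷ (b≢c ∷ arc⇒≢ b→x ∷ []) ∷ (arc⇒≢ c→x ∷ []) ∷ [] ∷ [])
    (fromArcs-hom _ _ (a→x ∷ b→x ∷ c→x ∷ [])))

  noA4-from : ¬ SubgraphOf A4 G → ∀ {u v x y} → Arc G u x → Arc G v x → Arc G x y → u ≢ v → ⊥
  noA4-from ¬A4 {u} {v} {x} {y} u→x v→x x→y u≢v =
    ¬A4 (embedding (u ∷ v ∷ x ∷ y ∷ [])
    ((u≢v ∷ arc⇒≢ u→x ∷ path2⇒≢ u→x x→y ∷ []) ∷ (arc⇒≢ v→x ∷ path2⇒≢ v→x x→y ∷ []) ∷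
     (arc⇒≢ x→y ∷ []) ∷ [] ∷ [])
    (fromArcs-hom _ _ (u→x ∷ v→x ∷ x→y ∷ [])))

  noH5-from : NoWalk3 G → NoDiamond G → ¬ SubgraphOf H5 G →
              ∀ {x y y′ z z′} → Arc G x y → Arc G y y′ → Arc G x z → Arc G z z′ → y ≢ z → ⊥
  noH5-from noWalk3 noDiamond ¬H5 {x} {y} {y′} {z} {z′} x→y y→y′ x→z z→z′ y≢z =
    ¬H5 (embedding (y′ ∷ y ∷ x ∷ z ∷ z′ ∷ [])
      ((≢-sym (arc⇒≢ y→y′) ∷ ≢-sym (path2⇒≢ x→y y→y′) ∷ y′≢z ∷ y′≢z′ ∷ []) ∷
       (≢-sym (arc⇒≢ x→y) ∷ y≢z ∷ y≢z′ ∷ []) ∷ (arc⇒≢ x→z ∷ path2⇒≢ x→z z→z′ ∷ []) ∷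
       (arc⇒≢ z→z′ ∷ []) ∷ [] ∷ [])
      (fromArcs-hom _ _ (x→y ∷ y→y′ ∷ x→z ∷ z→z′ ∷ [])))
    where
    y′≢z : y′ ≢ z
    y′≢z refl = noWalk3 x→y y→y′ z→z′
    y≢z′ : y ≢ z′
    y≢z′ refl = noWalk3 x→z z→z′ y→y′
    y′≢z′ : y′ ≢ z′
    y′≢z′ refl = noDiamond x→y y→y′ x→z z→z′ y≢z

  noB2-from : (∀ {u v x y} → Arc G u x → Arc G v x → Arc G x y → u ≢ v → ⊥) →
              NoAltSquare G → ¬ SubgraphOf B2 G →
              ∀ {a b c d e} → Arc G a b → Arc G c b → Arc G c d → Arc G e d →
              a ≢ c → c ≢ e → b ≢ d → ⊥
  noB2-from noA4 noAltSquare ¬B2 {a} {b} {c} {d} {e} a→b c→b c→d e→d a≢c c≢e b≢d =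
    ¬B2 (embedding (a ∷ b ∷ c ∷ d ∷ e ∷ [])
      ((arc⇒≢ a→b ∷ a≢c ∷ a≢d ∷ a≢e ∷ []) ∷ (≢-sym (arc⇒≢ c→b) ∷ b≢d ∷ b≢e ∷ []) ∷
       (arc⇒≢ c→d ∷ c≢e ∷ []) ∷ (≢-sym (arc⇒≢ e→d) ∷ []) ∷ [] ∷ [])
      (fromArcs-hom _ _ (a→b ∷ c→b ∷ c→d ∷ e→d ∷ [])))
    where
    a≢d : a ≢ d
    a≢d refl = noA4 c→d e→d a→b c≢e
    b≢e : b ≢ e
    b≢e refl = noA4 a→b c→b e→d a≢c
    a≢e : a ≢ e
    a≢e refl = noAltSquare a→b c→b c→d e→d a≢c b≢d

  local-from : NoWalk3 G → NoDiamond G → NoAltSquare G →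
               ¬ SubgraphOf H4 G → ¬ SubgraphOf A4 G → ¬ SubgraphOf H5 G → ¬ SubgraphOf B2 G →
               T3Local G
  local-from noWalk3 noDiamond noAltSquare ¬H4 ¬A4 ¬H5 ¬B2 = record
    { noWalk3 = noWalk3
    ; noA4    = noA4-from ¬A4
    ; noH4    = noH4-from ¬H4
    ; noH5    = noH5-from noWalk3 noDiamond ¬H5
    ; noB2    = noB2-from (noA4-from ¬A4) noAltSquare ¬B2
    }

HasSucc HasPred : (G : Digraph) → Vertex G → Set
HasSucc G v = ∃ λ w → Arc G v w
HasPred G v = ∃ λ w → Arc G w v

hasSucc? : (G : Digraph) (v : Vertex G) → Dec (HasSucc G v)
hasSucc? G v = any? λ w → T? (arc G v w)

hasPred? : (G : Digraph) (v : Vertex G) → Dec (HasPred G v)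
hasPred? G = hasSucc? (converse G)

-- Two sources with a common successor need distinct levels, so one of them is
-- raised to level 1, which requires that successor to be its only one.
Raised : (G : Digraph) → Vertex G → Set
Raised G v = ∃₂ λ w u → Arc G v w × Arc G u w × u ≢ v × ¬ HasPred G u ×
             (∀ w′ → Arc G v w′ → w′ ≡ w) × ((∃ λ a → Arc G u a × a ≢ w) ⊎ u < v)

raised? : (G : Digraph) (v : Vertex G) → Dec (Raised G v)
raised? G v = any? λ w → any? λ u →
  T? (arc G v w) ×-dec T? (arc G u w) ×-dec ¬? (u ≟ v) ×-dec ¬? (hasPred? G u) ×-dec
  all? (λ w′ → T? (arc G v w′) →-dec (w′ ≟ w)) ×-dec
  (any? (λ a → T? (arc G u a) ×-dec ¬? (a ≟ w)) ⊎-dec (u <? v))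

Lowered : (G : Digraph) → Vertex G → Set
Lowered G = Raised (converse G)

lowered? : (G : Digraph) (v : Vertex G) → Dec (Lowered G v)
lowered? G = raised? (converse G)

levelOf : ∀ {P S R L : Set} → Dec P → Dec S → Dec R → Dec L → Fin 3
levelOf (yes _) (yes _) _       _       = 1F
levelOf (no _)  (no _)  _       _       = 1F
levelOf (no _)  (yes _) (yes _) _       = 1F
levelOf (no _)  (yes _) (no _)  _       = 0F
levelOf (yes _) (no _)  _       (yes _) = 1F
levelOf (yes _) (no _)  _       (no _)  = 2F

level : (G : Digraph) → Vertex G → Fin 3
level G v = levelOf (hasPred? G v) (hasSucc? G v) (raised? G v) (lowered? G v)

levelOf-swap : ∀ {P S R L : Set} (p : Dec P) (s : Dec S) (r : Dec R) (l : Dec L) →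
               levelOf s p l r ≡ opposite (levelOf p s r l)
levelOf-swap (yes _) (yes _) _       _       = refl
levelOf-swap (no _)  (no _)  _       _       = refl
levelOf-swap (no _)  (yes _) (yes _) _       = refl
levelOf-swap (no _)  (yes _) (no _)  _       = refl
levelOf-swap (yes _) (no _)  _       (yes _) = refl
levelOf-swap (yes _) (no _)  _       (no _)  = refl

level-converse : ∀ G v → level (converse G) v ≡ opposite (level G v)
level-converse G v = levelOf-swap (hasPred? G v) (hasSucc? G v) (raised? G v) (lowered? G v)

data LevelView (G : Digraph) (v : Vertex G) : Fin 3 → Set where
  source   : ¬ HasPred G v → HasSucc G v → ¬ Raised G v → LevelView G v 0F
  raised   : ¬ HasPred G v → Raised G v → LevelView G v 1F
  isolated : ¬ HasPred G v → ¬ HasSucc G v → LevelView G v 1F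
  middle   : HasPred G v → HasSucc G v → LevelView G v 1F
  lowered  : Lowered G v → ¬ HasSucc G v → LevelView G v 1F
  sink     : HasPred G v → ¬ HasSucc G v → ¬ Lowered G v → LevelView G v 2F

view : ∀ G v → LevelView G v (level G v)
view G v = levelOf-view (hasPred? G v) (hasSucc? G v) (raised? G v) (lowered? G v)
  where
  levelOf-view : (p : Dec (HasPred G v)) (s : Dec (HasSucc G v)) (r : Dec (Raised G v))
                 (l : Dec (Lowered G v)) → LevelView G v (levelOf p s r l)
  levelOf-view (yes p) (yes s) _       _       = middle p s
  levelOf-view (no ¬p) (no ¬s) _       _       = isolated ¬p ¬s
  levelOf-view (no ¬p) (yes _) (yes r) _       = raised ¬p r
  levelOf-view (no ¬p) (yes s) (no ¬r) _       = source ¬p s ¬r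
  levelOf-view (yes _) (no ¬s) _       (yes l) = lowered l ¬s
  levelOf-view (yes p) (no ¬s) _       (no ¬l) = sink p ¬s ¬l

raised-partner : ∀ {G x y} → Raised G x → Arc G x y → ∃ λ u → Arc G u y × u ≢ x × ¬ HasPred G u
raised-partner (w , u , _ , u→w , u≢x , ¬pred , unique , _) x→y with unique _ x→y
... | refl = u , u→w , u≢x , ¬pred

lowered-partner : ∀ {G x y} → Lowered G y → Arc G x y → ∃ λ u → Arc G x u × u ≢ y × ¬ HasSucc G u
lowered-partner {G} = raised-partner {converse G}

lowered-unique-pred : ∀ {G a b y} → Lowered G y → Arc G a y → Arc G b y → a ≡ b
lowered-unique-pred (_ , _ , _ , _ , _ , _ , unique , _) a→y b→y =
  trans (unique _ a→y) (sym (unique _ b→y))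

lowered-by : ∀ {G x y z} → Arc G x y → Arc G x z → z ≢ y → ¬ HasSucc G z →
             ¬ (∃ λ a → Arc G a y × a ≢ x) → (∃ λ a → Arc G a z × a ≢ x) ⊎ z < y →
             Lowered G y
lowered-by {x = x} x→y x→z z≢y ¬succ only-x tie =
  x , _ , x→y , x→z , z≢y , ¬succ ,
  (λ a a→y → decidable-stable (a ≟ x) (λ a≢x → only-x (a , a→y , a≢x))) , tie

middle-then-lowered : ∀ {G x y} → T3Local (converse G) → HasPred G x → Arc G x y → Lowered G y → ⊥
middle-then-lowered Lᶜ (v , v→x) x→y Ly with lowered-partner Ly x→y
... | u , x→u , u≢y , _ = noA4 Lᶜ x→y x→u v→x (≢-sym u≢y)

-- converse (converse G) is G up to η, so dual statements come for free.
raised-then-middle : ∀ {G x y} → T3Local G → Raised G x → Arc G x y → HasSucc G y → ⊥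
raised-then-middle {G} L Rx x→y succ = middle-then-lowered {converse G} L succ x→y Rx

raised-then-lowered : ∀ {G x y} → Raised G x → Arc G x y → Lowered G y → ⊥
raised-then-lowered Rx x→y Ly with raised-partner Rx x→y
... | u , u→y , u≢x , _ = u≢x (lowered-unique-pred Ly u→y x→y)

module Construction (G : Digraph) (L : T3Local G) (Lᶜ : T3Local (converse G)) where

  level-hom : IsHom G T3 (level G)
  level-hom x y x→y with level G x | view G x | level G y | view G y
  ... | _ | _                  | _ | source ¬pred _ _   = ⊥-elim (¬pred (x , x→y))
  ... | _ | _                  | _ | raised ¬pred _     = ⊥-elim (¬pred (x , x→y))
  ... | _ | _                  | _ | isolated ¬pred _   = ⊥-elim (¬pred (x , x→y))
  ... | _ | isolated _ ¬succ   | _ | _                  = ⊥-elim (¬succ (y , x→y))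
  ... | _ | lowered _ ¬succ    | _ | _                  = ⊥-elim (¬succ (y , x→y))
  ... | _ | sink _ ¬succ _     | _ | _                  = ⊥-elim (¬succ (y , x→y))
  ... | _ | source _ _ _       | _ | middle _ _         = tt
  ... | _ | source _ _ _       | _ | lowered _ _        = tt
  ... | _ | source _ _ _       | _ | sink _ _ _         = tt
  ... | _ | raised _ _         | _ | sink _ _ _         = tt
  ... | _ | middle _ _         | _ | sink _ _ _         = tt
  ... | _ | middle (w , w→x) _ | _ | middle _ (z , y→z) = ⊥-elim (noWalk3 L w→x x→y y→z)
  ... | _ | middle pred _      | _ | lowered Ly _       = ⊥-elim (middle-then-lowered Lᶜ pred x→y Ly)
  ... | _ | raised _ Rx        | _ | middle _ succ      = ⊥-elim (raised-then-middle L Rx x→y succ)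
  ... | _ | raised _ Rx        | _ | lowered Ly _       = ⊥-elim (raised-then-lowered Rx x→y Ly)

  middle-lowered-siblings : ∀ {x y z} → Arc G x y → Arc G x z → HasSucc G y → Lowered G z →
                            y ≢ z → ⊥
  middle-lowered-siblings x→y x→z succ Lz y≢z with lowered-partner Lz x→z
  ... | u , x→u , u≢z , ¬succ = noH4 Lᶜ x→y x→z x→u y≢z y≢u (≢-sym u≢z)
    where
    y≢u : _ ≢ u
    y≢u refl = ¬succ succ

  ordered-lowered-siblings : ∀ {x y z} → Arc G x y → Arc G x z → Lowered G y → Lowered G z →
                             z < y → ⊥
  ordered-lowered-siblings {x} {y} {z} x→y x→z Ly (w , u , w→z , w→u , u≢z , _ , unique , tie) z<y
    with unique x x→z | u ≟ y
  ... | refl | no u≢y = noH4 Lᶜ x→y x→z w→u (≢-sym (<⇒≢ z<y)) (≢-sym u≢y) (≢-sym u≢z)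
  ... | refl | yes refl with tie
  ...   | inj₁ (a , a→y , a≢x) = a≢x (lowered-unique-pred Ly a→y x→y)
  ...   | inj₂ y<z             = <-asym y<z z<y

  lowered-siblings : ∀ {x y z} → Arc G x y → Arc G x z → Lowered G y → Lowered G z → y ≢ z → ⊥
  lowered-siblings {y = y} {z} x→y x→z Ly Lz y≢z with <-cmp y z
  ... | tri< y<z _ _ = ordered-lowered-siblings x→z x→y Lz Ly y<z
  ... | tri≈ _ y≡z _ = y≢z y≡z
  ... | tri> _ _ z<y = ordered-lowered-siblings x→y x→z Ly Lz z<y

  other-pred? : ∀ x v → Dec (∃ λ a → Arc G a v × a ≢ x)
  other-pred? x v = any? λ a → T? (arc G a v) ×-dec ¬? (a ≟ x)

  sink-siblings : ∀ {x y z} → Arc G x y → Arc G x z →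
                  ¬ HasSucc G y → ¬ Lowered G y → ¬ HasSucc G z → ¬ Lowered G z → y ≢ z → ⊥
  sink-siblings {x} {y} {z} x→y x→z ¬succy ¬Ly ¬succz ¬Lz y≢z
    with other-pred? x y | other-pred? x z
  ... | yes (a , a→y , a≢x) | yes (b , b→z , b≢x) = noB2 L a→y x→y x→z b→z a≢x (≢-sym b≢x) y≢z
  ... | no only-y | yes oz = ¬Ly (lowered-by x→y x→z (≢-sym y≢z) ¬succz only-y (inj₁ oz))
  ... | yes oy | no only-z = ¬Lz (lowered-by x→z x→y y≢z ¬succy only-z (inj₁ oy))
  ... | no only-y | no only-z with <-cmp y z
  ...   | tri< y<z _ _ = ¬Lz (lowered-by x→z x→y y≢z ¬succy only-z (inj₂ y<z))
  ...   | tri≈ _ y≡z _ = y≢z y≡z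
  ...   | tri> _ _ z<y = ¬Ly (lowered-by x→y x→z (≢-sym y≢z) ¬succz only-y (inj₂ z<y))

  siblings-levels-differ : ∀ {x y z} → Arc G x y → Arc G x z → y ≢ z → level G y ≢ level G z
  siblings-levels-differ {x} {y} {z} x→y x→z y≢z with level G y | view G y | level G z | view G z
  ... | _ | source ¬pred _ _ | _ | _                  = ⊥-elim (¬pred (x , x→y))
  ... | _ | raised ¬pred _   | _ | _                  = ⊥-elim (¬pred (x , x→y))
  ... | _ | isolated ¬pred _ | _ | _                  = ⊥-elim (¬pred (x , x→y))
  ... | _ | _                | _ | source ¬pred _ _  = ⊥-elim (¬pred (x , x→z))
  ... | _ | _                | _ | raised ¬pred _    = ⊥-elim (¬pred (x , x→z))
  ... | _ | _                | _ | isolated ¬pred _  = ⊥-elim (¬pred (x , x→z))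
  ... | _ | middle _ _       | _ | sink _ _ _         = λ ()
  ... | _ | lowered _ _      | _ | sink _ _ _         = λ ()
  ... | _ | sink _ _ _       | _ | middle _ _         = λ ()
  ... | _ | sink _ _ _       | _ | lowered _ _        = λ ()
  ... | _ | middle _ (p , y→p) | _ | middle _ (q , z→q) = λ _ → noH5 L x→y y→p x→z z→q y≢z
  ... | _ | middle _ succ    | _ | lowered Lz _       = λ _ → middle-lowered-siblings x→y x→z succ Lz y≢z
  ... | _ | lowered Ly _     | _ | middle _ succ      =
    λ _ → middle-lowered-siblings x→z x→y succ Ly (≢-sym y≢z)
  ... | _ | lowered Ly _     | _ | lowered Lz _       = λ _ → lowered-siblings x→y x→z Ly Lz y≢z
  ... | _ | sink _ ¬succy ¬Ly | _ | sink _ ¬succz ¬Lz =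
    λ _ → sink-siblings x→y x→z ¬succy ¬Ly ¬succz ¬Lz y≢z

  level-out-injective : ∀ x y z → Arc G x y → Arc G x z → level G y ≡ level G z → y ≡ z
  level-out-injective x y z x→y x→z e =
    decidable-stable (y ≟ z) (λ y≢z → siblings-levels-differ x→y x→z y≢z e)

local⇒ios : ∀ {G} → T3Local G → T3Local (converse G) → HasIosHom G T3
local⇒ios {G} L Lᶜ = level G , level-hom , level-in-injective , level-out-injective
  where
  open Construction G L Lᶜ
  level-in-injective : ∀ x y z → Arc G y x → Arc G z x → level G y ≡ level G z → y ≡ z
  level-in-injective x y z y→x z→x e =
    Construction.level-out-injective (converse G) Lᶜ L x y z y→x z→x
      (trans (level-converse G y) (trans (cong opposite e) (sym (level-converse G z))))

ForbiddenFree : Digraph → Set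
ForbiddenFree G =
  (∀ (o : Fin 4 → Bool) → ¬ SubgraphOf (C4orient o) G) ×
  ¬ SubgraphOf C3 G ×
  ¬ SubgraphOf P4 G ×
  ¬ SubgraphOf H4 G × ¬ SubgraphOf (converse H4) G ×
  ¬ SubgraphOf H5 G × ¬ SubgraphOf (converse H5) G ×
  ¬ SubgraphOf A4 G × ¬ SubgraphOf (converse A4) G ×
  ¬ SubgraphOf B2 G × ¬ SubgraphOf (converse B2) G

ios-forbids : ∀ {G H} → HasIosHom G T3 → ¬ T3Local H → ¬ SubgraphOf H G
ios-forbids {G} {H} φ nonlocal H⊆G = nonlocal (ios⇒local (ios-restrict {H} {G} {T3} H⊆G φ))

ios-forbids-converse : ∀ {G H} → HasIosHom G T3 → ¬ T3Local H → ¬ SubgraphOf (converse H) G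
ios-forbids-converse {G} {H} φ nonlocal H⊆G =
  nonlocal (ios⇒local (ios-converse (ios-restrict {converse H} {G} {T3} H⊆G φ)))

necessity : ∀ {G} → HasIosHom G T3 → ForbiddenFree G
necessity φ =
  (λ o → ios-forbids φ (C4-nonlocal o)) ,
  ios-forbids φ C3-nonlocal ,
  ios-forbids φ P4-nonlocal ,
  ios-forbids φ H4-nonlocal , ios-forbids-converse φ H4-nonlocal ,
  ios-forbids φ H5-nonlocal , ios-forbids-converse φ H5-nonlocal ,
  ios-forbids φ A4-nonlocal , ios-forbids-converse φ A4-nonlocal ,
  ios-forbids φ B2-nonlocal , ios-forbids-converse φ B2-nonlocal

sufficiency : ∀ {G} → Irreflexive G → Oriented G → ForbiddenFree G → HasIosHom G T3
sufficiency {G} irr ori (¬C4 , ¬C3 , ¬P4 , ¬H4 , ¬H4ᶜ , ¬H5 , ¬H5ᶜ , ¬A4 , ¬A4ᶜ , ¬B2 , ¬B2ᶜ) =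
  local⇒ios
    (FromSubgraphs.local-from irr ori walk3-free diamond-free altSquare-free ¬H4 ¬A4 ¬H5 ¬B2)
    (FromSubgraphs.local-from {converse G} irr (oriented-converse ori)
       (noWalk3-converse {G} walk3-free) (noDiamond-converse {G} diamond-free)
       (noAltSquare-converse {G} altSquare-free)
       (¬H4ᶜ ∘ subgraph-converse {H4} {G}) (¬A4ᶜ ∘ subgraph-converse {A4} {G})
       (¬H5ᶜ ∘ subgraph-converse {H5} {G}) (¬B2ᶜ ∘ subgraph-converse {B2} {G}))
  where
  walk3-free : NoWalk3 G
  walk3-free = FromSubgraphs.noWalk3-from irr ori ¬C3 ¬P4
  diamond-free : NoDiamond G
  diamond-free = FromSubgraphs.noDiamond-from irr ori (¬C4 diamond)
  altSquare-free : NoAltSquare G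
  altSquare-free = FromSubgraphs.noAltSquare-from irr ori (¬C4 alternating)

theorem3p3 : (G : Digraph) → Irreflexive G → Oriented G →
    HasIosHom G T3 ⇔
      ((∀ (o : Fin 4 → Bool) → ¬ SubgraphOf (C4orient o) G) ×
       ¬ SubgraphOf C3 G ×
       ¬ SubgraphOf P4 G ×
       ¬ SubgraphOf H4 G × ¬ SubgraphOf (converse H4) G ×
       ¬ SubgraphOf H5 G × ¬ SubgraphOf (converse H5) G ×
       ¬ SubgraphOf A4 G × ¬ SubgraphOf (converse A4) G ×
       ¬ SubgraphOf B2 G × ¬ SubgraphOf (converse B2) G)
theorem3p3 G irr ori = mk⇔ necessity (sufficiency irr ori)
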